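{- Let $p,q\ge 1$ and let $G=K_{p,q}$ be the complete bipartite graph on $n=p+q$ vertices. Then $b^A_g(G)=b^I_g(G)=0$ if $pq$ is even, and $b^A_g(G)=b^I_g(G)=1$ if $pq$ is odd.
   Context: The balance game on a finite simple graph $G$ is played by two players, Admirable (A) and Impish (I), who alternately select a not-yet-labeled vertex of $G$ until all vertices are labeled; Admirable labels each vertex she selects by $0$ and Impish labels each vertex he selects by $1$. Each edge receives the sum modulo $2$ of the labels of its endpoints. Let $e_0$ and $e_1$ be the numbers of edges labeled $0$ and $1$ at the end; the discrepancy is $d=e_1-e_0$. Admirable tries to minimize $d$ and Impish tries to maximize $d$. $b^A_g(G)$ is the value of $d$ under optimal play of both players when Admirable moves first, and $b^I_g(G)$ is the value under optimal play when Impish moves first. -}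

module Defs where

open import Data.Bool using (Bool; true; false; _xor_; if_then_else_)
open import Data.Nat using (ℕ; zero; suc; _<ᵇ_)
open import Data.Fin using (Fin; toℕ; _≟_)
open import Data.List using (List; []; _∷_; map; filter; concatMap; foldr)
open import Data.List.Base using (allFin)
open import Data.Maybe using (Maybe; just; nothing; is-nothing)
open import Data.Product using (_×_; _,_)
open import Data.Integer using (ℤ; +_; -[1+_]; _⊓_; _⊔_; _+_)
open import Relation.Nullary using (yes; no)
open import Relation.Binary.PropositionalEquality using (_≡_)

record SimpleGraph (n : ℕ) : Set where
  field
    adj    : Fin n → Fin n → Bool
    sym    : ∀ i j → adj i j ≡ adj j i
    irrefl : ∀ i → adj i i ≡ false
open SimpleGraph public

-- Players: Admirable labels by 0 (false), Impish labels by 1 (true).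
data Player : Set where
  Adm Imp : Player

other : Player → Player
other Adm = Imp
other Imp = Adm

label : Player → Bool
label Adm = false
label Imp = true

Labelling : ℕ → Set
Labelling n = Fin n → Maybe Bool

lab0 : Maybe Bool → Bool
lab0 (just b) = b
lab0 nothing  = false   -- irrelevant: at the end of a game every vertex is labeled

-- All ordered pairs (i , j) with toℕ i < toℕ j, i.e. each unordered pair once.
pairs : (n : ℕ) → List (Fin n × Fin n)
pairs n = concatMap (λ i → map (λ j → i , j)
                       (filter (λ j → toℕ i Data.Nat.<? toℕ j) (allFin n)))
                    (allFin n)
  where import Data.Nat

-- Contribution of a pair: 0 if not an edge, +1 if edge labeled 1, -1 if edge labeled 0.
edgeVal : ∀ {n} → SimpleGraph n → Labelling n → Fin n × Fin n → ℤ
edgeVal G s (i , j) =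
  if adj G i j
  then (if lab0 (s i) xor lab0 (s j) then + 1 else -[1+ 0 ])
  else + 0

discrepancy : ∀ {n} → SimpleGraph n → Labelling n → ℤ
discrepancy {n} G s = foldr (λ e acc → edgeVal G s e + acc) (+ 0) (pairs n)

unlabeled : ∀ {n} → Labelling n → List (Fin n)
unlabeled {n} s = filter (λ v → Data.Bool.Properties.T? (is-nothing (s v))) (allFin n)
  where import Data.Bool.Properties

assign : ∀ {n} → Labelling n → Fin n → Bool → Labelling n
assign s v b w with w ≟ v
... | yes _ = just b
... | no  _ = s w

optimum : Player → ℤ → List ℤ → ℤ
optimum p x []       = x
optimum Adm x (y ∷ ys) = x ⊓ optimum Adm y ys
optimum Imp x (y ∷ ys) = x ⊔ optimum Imp y ys

-- Value of the game under optimal play from labelling s with player p to move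
-- and k moves remaining (k = number of unlabeled vertices).
value : ∀ {n} → SimpleGraph n → ℕ → Player → Labelling n → ℤ
value G zero    p s = discrepancy G s
value G (suc k) p s with unlabeled s
... | []     = discrepancy G s
... | v ∷ vs = optimum p (next v) (map next vs)
  where next : _ → ℤ
        next w = value G k (other p) (assign s w (label p))

bgA : ∀ {n} → SimpleGraph n → ℤ
bgA {n} G = value G n Adm (λ _ → nothing)

bgI : ∀ {n} → SimpleGraph n → ℤ
bgI {n} G = value G n Imp (λ _ → nothing)

-- Complete bipartite graph K_{p,q} on Fin (p + q): parts {0..p-1} and {p..p+q-1}.
side : ∀ {n} → ℕ → Fin n → Bool
side p i = toℕ i <ᵇ p

K : (p q : ℕ) → SimpleGraph (p Data.Nat.+ q)
K p q = record
  { adj    = λ i j → side p i xor side p j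
  ; sym    = λ i j → Data.Bool.Properties.xor-comm (side p i) (side p j)
  ; irrefl = λ i → Data.Bool.Properties.xor-same (side p i)
  }
  where import Data.Bool.Properties
        import Data.Nat

{-# OPTIONS --safe #-}
-- Give label 0 the spin +1 and label 1 the spin −1. An edge uv of K_{p,q} then contributes
-- −spin(u)·spin(v), so a complete labelling has discrepancy −X·Y, where X and Y are the spin
-- sums of the two parts. During play only four numbers matter: the parities of the numbers of
-- unlabeled vertices in the two parts and the spin sums of the labelled vertices. From such a
-- position the value has a closed form: each player can answer a move in a part by a
-- move in the same part with the opposite spin, so only the parity leftovers count; an odd part
-- receives the spin of the player to move, and when both parts are odd that player chooses which
-- part gets his spin and which the opponent's. The closed form satisfies the minimax recursion
-- defining the value, and at the empty labelling it is 1 if p and q are both odd and 0 otherwise.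
module Submission where

open import Algebra.Bundles using (Monoid; CommutativeMonoid)
open import Data.Bool using (Bool; true; false; not; _xor_; if_then_else_; T)
open import Data.Bool.Properties using (if-eta; T?; not-injective)
open import Data.Empty using (⊥-elim)
open import Data.Fin using (Fin; zero; suc; toℕ; _≟_)
open import Data.Fin.Properties using (punchInᵢ≢i)
open import Data.Integer using (ℤ; +_; 0ℤ; 1ℤ; -1ℤ; _+_; _*_; -_; _≤_)
import Data.Integer.Properties as ℤₚ
open import Data.List using (List; []; _∷_; _++_; map; filter; concatMap; foldr; tabulate; allFin)
open import Data.List.Membership.Propositional using (_∈_)
open import Data.List.Membership.Propositional.Properties
  using (∈-map⁺; ∈-map⁻; ∈-filter⁺; ∈-filter⁻; ∈-allFin)
open import Data.List.Relation.Unary.Any using (here; there)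
open import Data.Maybe using (Maybe; just; nothing; is-nothing)
open import Data.Nat using (ℕ; zero; suc; _<ᵇ_; _<?_; parity)
import Data.Nat as ℕ
import Data.Nat.Properties as ℕₚ
open import Data.Parity.Base as ℙ using (Parity; 0ℙ; 1ℙ; _⁻¹)
open import Data.Parity.Properties using (suc-homo-⁻¹; *-homo-*)
open import Data.Product using (_×_; _,_; ∃-syntax; proj₂)
open import Data.Sum using (inj₁; inj₂)
open import Data.Unit using (tt)
open import Function using (_∘_)
open import Relation.Binary.PropositionalEquality
  using (_≡_; _≢_; refl; sym; trans; cong; cong₂; subst; module ≡-Reasoning)
open import Relation.Nullary using (does; yes; no; contradiction)
open import Relation.Unary using (Pred; Decidable)

open import Defs hiding (sym)

assign-self : ∀ {n} (s : Labelling n) w b → assign s w b w ≡ just b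
assign-self s w b with w ≟ w
... | yes _   = refl
... | no w≢w = contradiction refl w≢w

assign-other : ∀ {n} (s : Labelling n) {w i} b → i ≢ w → assign s w b i ≡ s i
assign-other s {w} {i} b i≢w with i ≟ w
... | yes i≡w = contradiction i≡w i≢w
... | no _    = refl

module ListSum {c ℓ} (M : Monoid c ℓ) where
  open Monoid M renaming (refl to ≈-refl; sym to ≈-sym; trans to ≈-trans)
  open import Algebra.Properties.Monoid.Sum M using (sum; sum-syntax; sum-cong-≋)

  sumList : ∀ {A : Set} → (A → Carrier) → List A → Carrier
  sumList f = foldr (λ x acc → f x ∙ acc) ε

  sumList-++ : ∀ {A : Set} (f : A → Carrier) xs ys →
               sumList f (xs ++ ys) ≈ sumList f xs ∙ sumList f ys
  sumList-++ f []       ys = ≈-sym (identityˡ _)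
  sumList-++ f (x ∷ xs) ys = ≈-trans (∙-congˡ (sumList-++ f xs ys)) (≈-sym (assoc _ _ _))

  sumList-concatMap : ∀ {A B : Set} (f : B → Carrier) (g : A → List B) xs →
                      sumList f (concatMap g xs) ≈ sumList (sumList f ∘ g) xs
  sumList-concatMap f g []       = ≈-refl
  sumList-concatMap f g (x ∷ xs) =
    ≈-trans (sumList-++ f (g x) _) (∙-congˡ (sumList-concatMap f g xs))

  sumList-map : ∀ {A B : Set} (f : B → Carrier) (g : A → B) xs →
                sumList f (map g xs) ≈ sumList (f ∘ g) xs
  sumList-map f g []       = ≈-refl
  sumList-map f g (x ∷ xs) = ∙-congˡ (sumList-map f g xs)

  sumList-filter : ∀ {A : Set} {p} {P : Pred A p} (P? : Decidable P) (f : A → Carrier) xs →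
                   sumList f (filter P? xs) ≈ sumList (λ x → if does (P? x) then f x else ε) xs
  sumList-filter P? f []       = ≈-refl
  sumList-filter P? f (x ∷ xs) with does (P? x)
  ... | true  = ∙-congˡ (sumList-filter P? f xs)
  ... | false = ≈-trans (sumList-filter P? f xs) (≈-sym (identityˡ _))

  sumList-tabulate : ∀ {A : Set} {n} (f : A → Carrier) (g : Fin n → A) →
                     sumList f (tabulate g) ≈ sum (f ∘ g)
  sumList-tabulate {n = zero}  f g = ≈-refl
  sumList-tabulate {n = suc n} f g = ∙-congˡ (sumList-tabulate f (g ∘ suc))

  sumList-pairs : ∀ {n} (f : Fin n × Fin n → Carrier) →
                  sumList f (pairs n) ≈ ∑[ i < n ] ∑[ j < n ] (if toℕ i <ᵇ toℕ j then f (i , j) else ε)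
  sumList-pairs {n} f = begin
    sumList f (concatMap row (allFin n))
      ≈⟨ sumList-concatMap f row (allFin n) ⟩
    sumList (sumList f ∘ row) (allFin n)
      ≈⟨ sumList-tabulate (sumList f ∘ row) (λ i → i) ⟩
    ∑[ i < n ] sumList f (row i)
      ≈⟨ sum-cong-≋ (λ i → sumList-map f (i ,_) (later i)) ⟩
    ∑[ i < n ] sumList (λ j → f (i , j)) (later i)
      ≈⟨ sum-cong-≋ (λ i → sumList-filter (λ j → toℕ i <? toℕ j) (λ j → f (i , j)) (allFin n)) ⟩
    ∑[ i < n ] sumList (term i) (allFin n)
      ≈⟨ sum-cong-≋ (λ i → sumList-tabulate (term i) (λ j → j)) ⟩
    ∑[ i < n ] ∑[ j < n ] term i j
      ∎
    where
    open import Relation.Binary.Reasoning.Setoid setoid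
    later : Fin n → List (Fin n)
    later i = filter (λ j → toℕ i <? toℕ j) (allFin n)
    row : Fin n → List (Fin n × Fin n)
    row i = map (i ,_) (later i)
    term : Fin n → Fin n → Carrier
    term i j = if toℕ i <ᵇ toℕ j then f (i , j) else ε

module LabellingSum {c ℓ} (M : CommutativeMonoid c ℓ) where
  open CommutativeMonoid M renaming (refl to ≈-refl; sym to ≈-sym; trans to ≈-trans)
  open import Algebra.Properties.CommutativeMonoid.Sum M public
    using (sum; sum-syntax; sum-cong-≋; sum-replicate-zero)
  open import Algebra.Properties.CommutativeMonoid.Sum M using (sum-remove)
  open import Algebra.Properties.CommutativeSemigroup commutativeSemigroup using (x∙yz≈y∙xz)
  open import Data.Vec.Functional using (removeAt)
  open import Relation.Binary.Reasoning.Setoid setoid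

  sum-update : ∀ {n} (f g : Fin n → Carrier) w → (∀ i → i ≢ w → f i ≈ g i) →
               f w ∙ sum g ≈ g w ∙ sum f
  sum-update {suc n} f g w f≈g = begin
    f w ∙ sum g                      ≈⟨ ∙-congˡ (sum-remove {i = w} g) ⟩
    f w ∙ (g w ∙ sum (removeAt g w)) ≈⟨ x∙yz≈y∙xz (f w) (g w) _ ⟩
    g w ∙ (f w ∙ sum (removeAt g w)) ≈⟨ ∙-congˡ (∙-congˡ (sum-cong-≋ g≈f)) ⟩
    g w ∙ (f w ∙ sum (removeAt f w)) ≈⟨ ∙-congˡ (sum-remove {i = w} f) ⟨
    g w ∙ sum f                      ∎
    where
    g≈f : ∀ j → removeAt g w j ≈ removeAt f w j
    g≈f j = ≈-sym (f≈g _ (punchInᵢ≢i w j))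

  partSum : ∀ {n} → (Fin n → Bool) → (Maybe Bool → Carrier) → Labelling n → Carrier
  partSum π φ s = sum (λ i → if π i then φ (s i) else ε)

  partSum-cong : ∀ {n} π φ ψ (s : Labelling n) → (∀ i → φ (s i) ≈ ψ (s i)) →
                 partSum π φ s ≈ partSum π ψ s
  partSum-cong π φ ψ s φ≈ψ = sum-cong-≋ termwise
    where
    termwise : ∀ i → (if π i then φ (s i) else ε) ≈ (if π i then ψ (s i) else ε)
    termwise i with π i
    ... | true  = φ≈ψ i
    ... | false = ≈-refl

  partSum-ε : ∀ {n} π φ (s : Labelling n) → (∀ i → φ (s i) ≈ ε) → partSum π φ s ≈ ε
  partSum-ε {n} π φ s φ≈ε = ≈-trans (sum-cong-≋ termwise) (sum-replicate-zero n)
    where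
    termwise : ∀ i → (if π i then φ (s i) else ε) ≈ ε
    termwise i with π i
    ... | true  = φ≈ε i
    ... | false = ≈-refl

  partSum-assign-in : ∀ {n} π φ (s : Labelling n) {w b} → π w ≡ true →
                      φ (s w) ∙ partSum π φ (assign s w b) ≈ φ (just b) ∙ partSum π φ s
  partSum-assign-in {n} π φ s {w} {b} πw = begin
    φ (s w) ∙ partSum π φ s′    ≡⟨ cong (_∙ partSum π φ s′) (term-w s) ⟨
    term s w ∙ sum (term s′)    ≈⟨ sum-update (term s) (term s′) w unchanged ⟩
    term s′ w ∙ sum (term s)    ≡⟨ cong (_∙ partSum π φ s) (trans (term-w s′) (cong φ (assign-self s w b))) ⟩
    φ (just b) ∙ partSum π φ s  ∎
    where
    s′ : Labelling n
    s′ = assign s w b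
    term : Labelling n → Fin n → Carrier
    term t i = if π i then φ (t i) else ε
    term-w : ∀ t → term t w ≡ φ (t w)
    term-w t = cong (if_then φ (t w) else ε) πw
    unchanged : ∀ i → i ≢ w → term s i ≈ term s′ i
    unchanged i i≢w = reflexive (cong (λ m → if π i then φ m else ε) (sym (assign-other s b i≢w)))

  partSum-assign-out : ∀ {n} π φ (s : Labelling n) {w b} → π w ≡ false →
                       partSum π φ (assign s w b) ≈ partSum π φ s
  partSum-assign-out π φ s {w} {b} πw = sum-cong-≋ termwise
    where
    termwise : ∀ i → (if π i then φ (assign s w b i) else ε) ≈ (if π i then φ (s i) else ε)
    termwise i with w ≟ i
    ... | yes refl rewrite πw = ≈-refl
    ... | no w≢i = reflexive (cong (λ m → if π i then φ m else ε) (assign-other s b (w≢i ∘ sym)))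

module ℕ-sum where
  open LabellingSum ℕₚ.+-0-commutativeMonoid public

  sum-≡0 : ∀ {n} (f : Fin n → ℕ) → sum f ≡ 0 → ∀ i → f i ≡ 0
  sum-≡0 f ∑f≡0 zero    = ℕₚ.m+n≡0⇒m≡0 (f zero) ∑f≡0
  sum-≡0 f ∑f≡0 (suc i) = sum-≡0 (f ∘ suc) (ℕₚ.m+n≡0⇒n≡0 (f zero) ∑f≡0) i

  sum-nonzero : ∀ {n} (f : Fin n → ℕ) → sum f ≢ 0 → ∃[ i ] f i ≢ 0
  sum-nonzero {zero}  f ∑f≢0 = contradiction refl ∑f≢0
  sum-nonzero {suc n} f ∑f≢0 with f zero ℕ.≟ 0
  ... | no f₀≢0  = zero , f₀≢0
  ... | yes f₀≡0 with sum-nonzero (f ∘ suc) (λ ∑f′≡0 → ∑f≢0 (cong₂ ℕ._+_ f₀≡0 ∑f′≡0))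
  ...   | i , fi≢0 = suc i , fi≢0

  sum-ones : ∀ n → ∑[ i < n ] 1 ≡ n
  sum-ones zero    = refl
  sum-ones (suc n) = cong suc (sum-ones n)

  count-< : ∀ n m → m ℕ.≤ n → ∑[ i < n ] (if toℕ i <ᵇ m then 1 else 0) ≡ m
  count-< n       zero    _           = sum-replicate-zero n
  count-< (suc n) (suc m) (ℕ.s≤s m≤n) = cong suc (count-< n m m≤n)

  count-≥ : ∀ n m → ∑[ i < n ] (if not (toℕ i <ᵇ m) then 1 else 0) ≡ n ℕ.∸ m
  count-≥ zero    zero    = refl
  count-≥ zero    (suc m) = refl
  count-≥ (suc n) zero    = cong suc (count-≥ n zero)
  count-≥ (suc n) (suc m) = count-≥ n m

-- The discrepancy of K_{p,q} once the spins of its two parts sum to X and Y.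
cross : ℤ → ℤ → ℤ
cross X Y = - (X * Y)

module ℤ-sum where
  open LabellingSum ℤₚ.+-0-commutativeMonoid public
  open import Algebra.Properties.Semiring.Sum ℤₚ.+-*-semiring using (*-distribˡ-sum; *-distribʳ-sum)

  ∑-neg : ∀ {n} (f : Fin n → ℤ) → ∑[ i < n ] (- f i) ≡ - sum f
  ∑-neg {n} f = begin
    ∑[ i < n ] (- f i)      ≡⟨ sum-cong-≋ (λ i → ℤₚ.-1*i≡-i (f i)) ⟨
    ∑[ i < n ] (-1ℤ * f i)  ≡⟨ *-distribˡ-sum -1ℤ f ⟨
    -1ℤ * sum f             ≡⟨ ℤₚ.-1*i≡-i (sum f) ⟩
    - sum f                 ∎
    where open ≡-Reasoning

  ∑-cross : ∀ {m n} (f : Fin m → ℤ) (g : Fin n → ℤ) →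
            ∑[ i < m ] ∑[ j < n ] cross (f i) (g j) ≡ cross (sum f) (sum g)
  ∑-cross {m} {n} f g = begin
    ∑[ i < m ] ∑[ j < n ] (- (f i * g j))
      ≡⟨ sum-cong-≋ (λ i → sum-cong-≋ (λ j → ℤₚ.neg-distribˡ-* (f i) (g j))) ⟩
    ∑[ i < m ] ∑[ j < n ] ((- f i) * g j)
      ≡⟨ sum-cong-≋ (λ i → *-distribˡ-sum (- f i) g) ⟨
    ∑[ i < m ] ((- f i) * sum g)
      ≡⟨ *-distribʳ-sum (sum g) (-_ ∘ f) ⟨
    (∑[ i < m ] (- f i)) * sum g
      ≡⟨ cong (_* sum g) (∑-neg f) ⟩
    (- sum f) * sum g
      ≡⟨ ℤₚ.neg-distribˡ-* (sum f) (sum g) ⟨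
    - (sum f * sum g)
      ∎
    where open ≡-Reasoning

spin : Bool → ℤ
spin false = 1ℤ
spin true  = -1ℤ

mark : Player → ℤ
mark pl = spin (label pl)

mark-cancel : ∀ pl X → mark (other pl) + (mark pl + X) ≡ X
mark-cancel Adm X = trans (sym (ℤₚ.+-assoc -1ℤ 1ℤ X)) (ℤₚ.+-identityˡ X)
mark-cancel Imp X = trans (sym (ℤₚ.+-assoc 1ℤ -1ℤ X)) (ℤₚ.+-identityˡ X)

other-involutive : ∀ pl → other (other pl) ≡ pl
other-involutive Adm = refl
other-involutive Imp = refl

infix 4 _≼[_]_

data _≼[_]_ : ℤ → Player → ℤ → Set where
  adm : ∀ {x y} → x ≤ y → x ≼[ Adm ] y
  imp : ∀ {x y} → y ≤ x → x ≼[ Imp ] y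

≼-reflexive : ∀ pl {x y} → x ≡ y → x ≼[ pl ] y
≼-reflexive Adm x≡y = adm (ℤₚ.≤-reflexive x≡y)
≼-reflexive Imp x≡y = imp (ℤₚ.≤-reflexive (sym x≡y))

≼-antisym : ∀ {pl x y} → x ≼[ pl ] y → y ≼[ pl ] x → x ≡ y
≼-antisym (adm x≤y) (adm y≤x) = ℤₚ.≤-antisym x≤y y≤x
≼-antisym (imp y≤x) (imp x≤y) = ℤₚ.≤-antisym x≤y y≤x

≼-respˡ : ∀ {pl x x′ y} → x ≡ x′ → x ≼[ pl ] y → x′ ≼[ pl ] y
≼-respˡ refl x≼y = x≼y

≼-other : ∀ pl {x y} → x ≼[ other pl ] y → y ≼[ pl ] x
≼-other Adm (imp x≤y) = adm x≤y
≼-other Imp (adm x≤y) = imp x≤y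

optimum-≼ : ∀ pl {y x xs} → y ∈ x ∷ xs → optimum pl x xs ≼[ pl ] y
optimum-≼ pl  {xs = []}    (here refl) = ≼-reflexive pl refl
optimum-≼ Adm {xs = _ ∷ _} (here refl) = adm (ℤₚ.i⊓j≤i _ _)
optimum-≼ Adm {xs = _ ∷ _} (there y∈) with optimum-≼ Adm y∈
... | adm o≤y = adm (ℤₚ.≤-trans (ℤₚ.i⊓j≤j _ _) o≤y)
optimum-≼ Imp {xs = _ ∷ _} (here refl) = imp (ℤₚ.i≤i⊔j _ _)
optimum-≼ Imp {xs = _ ∷ _} (there y∈) with optimum-≼ Imp y∈
... | imp y≤o = imp (ℤₚ.≤-trans y≤o (ℤₚ.i≤j⊔i _ _))

optimum-∈ : ∀ pl x xs → optimum pl x xs ∈ x ∷ xs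
optimum-∈ pl  x []       = here refl
optimum-∈ Adm x (y ∷ ys) with ℤₚ.⊓-sel x (optimum Adm y ys)
... | inj₁ x⊓o≡x = here x⊓o≡x
... | inj₂ x⊓o≡o = there (subst (_∈ y ∷ ys) (sym x⊓o≡o) (optimum-∈ Adm y ys))
optimum-∈ Imp x (y ∷ ys) with ℤₚ.⊔-sel x (optimum Imp y ys)
... | inj₁ x⊔o≡x = here x⊔o≡x
... | inj₂ x⊔o≡o = there (subst (_∈ y ∷ ys) (sym x⊔o≡o) (optimum-∈ Imp y ys))

optimum-unique : ∀ pl {c x xs} → c ∈ x ∷ xs → (∀ {y} → y ∈ x ∷ xs → c ≼[ pl ] y) →
                 optimum pl x xs ≡ c
optimum-unique pl {x = x} {xs} c∈ c≼ = ≼-antisym (optimum-≼ pl c∈) (c≼ (optimum-∈ pl x xs))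

-- Parities of the numbers of unlabeled vertices in the parts P and Q, and spin sums of their
-- labelled vertices.
record Position : Set where
  constructor pos
  field
    parityP parityQ : Parity
    spinP spinQ     : ℤ
open Position

move : Player → Bool → Position → Position
move pl true  (pos ρ σ X Y) = pos (ρ ⁻¹) σ (mark pl + X) Y
move pl false (pos ρ σ X Y) = pos ρ (σ ⁻¹) X (mark pl + Y)

-- Both parts have one vertex left over: the one in part b gets the spin of pl, the other one
-- the spin of the opponent.
leftover : Player → ℤ → ℤ → Bool → ℤ
leftover pl X Y true  = cross (mark pl + X) (mark (other pl) + Y)
leftover pl X Y false = cross (mark (other pl) + X) (mark pl + Y)

endgame : Player → Position → ℤ
endgame pl (pos 0ℙ 0ℙ X Y) = cross X Y
endgame pl (pos 1ℙ 0ℙ X Y) = cross (mark pl + X) Y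
endgame pl (pos 0ℙ 1ℙ X Y) = cross X (mark pl + Y)
endgame pl (pos 1ℙ 1ℙ X Y) = optimum pl (leftover pl X Y true) (leftover pl X Y false ∷ [])

endgame-optimal : ∀ pl st b → endgame pl st ≼[ pl ] endgame (other pl) (move pl b st)
endgame-optimal pl (pos 0ℙ 0ℙ X Y) true  =
  ≼-reflexive pl (cong (λ X′ → cross X′ Y) (sym (mark-cancel pl X)))
endgame-optimal pl (pos 0ℙ 0ℙ X Y) false =
  ≼-reflexive pl (cong (cross X) (sym (mark-cancel pl Y)))
endgame-optimal pl (pos 1ℙ 0ℙ X Y) true  = ≼-reflexive pl refl
endgame-optimal pl (pos 1ℙ 0ℙ X Y) false =
  ≼-respˡ (cong₂ cross (cong (λ m → mark m + X) (other-involutive pl)) (mark-cancel pl Y))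
          (≼-other pl (optimum-≼ (other pl) {x = leftover (other pl) X (mark pl + Y) true}
                                            (there (here refl))))
endgame-optimal pl (pos 0ℙ 1ℙ X Y) true  =
  ≼-respˡ (cong₂ cross (mark-cancel pl X) (cong (λ m → mark m + Y) (other-involutive pl)))
          (≼-other pl (optimum-≼ (other pl) {xs = leftover (other pl) (mark pl + X) Y false ∷ []}
                                            (here refl)))
endgame-optimal pl (pos 0ℙ 1ℙ X Y) false = ≼-reflexive pl refl
endgame-optimal pl (pos 1ℙ 1ℙ X Y) true  = optimum-≼ pl {xs = leftover pl X Y false ∷ []} (here refl)
endgame-optimal pl (pos 1ℙ 1ℙ X Y) false = optimum-≼ pl {x = leftover pl X Y true} (there (here refl))

endgame-attained : ∀ pl st {Available : Bool → Set} → ∃[ b ] Available b →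
                   (parityP st ≡ 1ℙ → Available true) → (parityQ st ≡ 1ℙ → Available false) →
                   ∃[ b ] Available b × endgame (other pl) (move pl b st) ≡ endgame pl st
endgame-attained pl (pos 0ℙ 0ℙ X Y) (true  , avail) _ _ =
  true , avail , cong (λ X′ → cross X′ Y) (mark-cancel pl X)
endgame-attained pl (pos 0ℙ 0ℙ X Y) (false , avail) _ _ =
  false , avail , cong (cross X) (mark-cancel pl Y)
endgame-attained pl (pos 1ℙ 0ℙ X Y) _ availP _ = true  , availP refl , refl
endgame-attained pl (pos 0ℙ 1ℙ X Y) _ _ availQ = false , availQ refl , refl
endgame-attained pl (pos 1ℙ 1ℙ X Y) _ availP availQ
  with optimum-∈ pl (leftover pl X Y true) (leftover pl X Y false ∷ [])
... | here  opt≡P        = true  , availP refl , sym opt≡P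
... | there (here opt≡Q) = false , availQ refl , sym opt≡Q

optimum-moves : ∀ pl st {A : Set} (part : A → Bool) (val : A → ℤ) x xs →
                (∀ {w} → w ∈ x ∷ xs → val w ≡ endgame (other pl) (move pl (part w) st)) →
                (parityP st ≡ 1ℙ → ∃[ w ] w ∈ x ∷ xs × part w ≡ true) →
                (parityQ st ≡ 1ℙ → ∃[ w ] w ∈ x ∷ xs × part w ≡ false) →
                optimum pl (val x) (map val xs) ≡ endgame pl st
optimum-moves pl st part val x xs val≡ availP availQ = optimum-unique pl attained bounded
  where
  bounded : ∀ {y} → y ∈ map val (x ∷ xs) → endgame pl st ≼[ pl ] y
  bounded y∈ with ∈-map⁻ val y∈
  ... | w , w∈ , refl = subst (endgame pl st ≼[ pl ]_) (sym (val≡ w∈)) (endgame-optimal pl st (part w))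
  Available : Bool → Set
  Available b = ∃[ w ] w ∈ x ∷ xs × part w ≡ b
  attained : endgame pl st ∈ map val (x ∷ xs)
  attained with endgame-attained pl st {Available} (part x , x , here refl , refl) availP availQ
  ... | _ , (w , w∈ , refl) , after≡ =
    subst (_∈ map val (x ∷ xs)) (trans (val≡ w∈) after≡) (∈-map⁺ val w∈)

bit : Parity → ℕ
bit 0ℙ = 0
bit 1ℙ = 1

bit-parity : ∀ m → bit (parity m) ≡ m ℕ.% 2
bit-parity zero          = refl
bit-parity (suc zero)    = refl
bit-parity (suc (suc m)) = bit-parity m

endgame-origin : ∀ pl ρ σ → endgame pl (pos ρ σ 0ℤ 0ℤ) ≡ + bit (ρ ℙ.* σ)
endgame-origin Adm 0ℙ 0ℙ = refl
endgame-origin Adm 0ℙ 1ℙ = refl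
endgame-origin Adm 1ℙ 0ℙ = refl
endgame-origin Adm 1ℙ 1ℙ = refl
endgame-origin Imp 0ℙ 0ℙ = refl
endgame-origin Imp 0ℙ 1ℙ = refl
endgame-origin Imp 1ℙ 0ℙ = refl
endgame-origin Imp 1ℙ 1ℙ = refl

free : Maybe Bool → ℕ
free nothing  = 1
free (just _) = 0

labelSpin : Maybe Bool → ℤ
labelSpin nothing  = 0ℤ
labelSpin (just b) = spin b

labelSpin-complete : ∀ {m} → free m ≡ 0 → labelSpin m ≡ spin (lab0 m)
labelSpin-complete {just _} _ = refl

freeIn : ∀ {n} → (Fin n → Bool) → Labelling n → ℕ
freeIn π = ℕ-sum.partSum π free

spinIn : ∀ {n} → (Fin n → Bool) → Labelling n → ℤ
spinIn π = ℤ-sum.partSum π labelSpin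

freeCount : ∀ {n} → Labelling n → ℕ
freeCount = freeIn (λ _ → true)

freeIn-assign : ∀ {n} π (s : Labelling n) {w b} → π w ≡ true → s w ≡ nothing →
                suc (freeIn π (assign s w b)) ≡ freeIn π s
freeIn-assign π s {w} {b} πw sw =
  subst (λ m → free m ℕ.+ freeIn π (assign s w b) ≡ freeIn π s) sw (ℕ-sum.partSum-assign-in π free s πw)

parity-freeIn-assign : ∀ {n} π (s : Labelling n) {w b} → π w ≡ true → s w ≡ nothing →
                       parity (freeIn π (assign s w b)) ≡ parity (freeIn π s) ⁻¹
parity-freeIn-assign π s {w} {b} πw sw =
  trans (sym (suc-homo-⁻¹ (freeIn π (assign s w b)))) (cong (λ m → parity m ⁻¹) (freeIn-assign π s πw sw))

spinIn-assign : ∀ {n} π (s : Labelling n) {w b} → π w ≡ true → s w ≡ nothing →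
                spinIn π (assign s w b) ≡ spin b + spinIn π s
spinIn-assign π s {w} {b} πw sw = trans (sym (ℤₚ.+-identityˡ _))
  (subst (λ m → labelSpin m + spinIn π (assign s w b) ≡ spin b + spinIn π s) sw
         (ℤ-sum.partSum-assign-in π labelSpin s πw))

freeIn-nonzero : ∀ {n} π (s : Labelling n) → freeIn π s ≢ 0 → ∃[ i ] π i ≡ true × s i ≡ nothing
freeIn-nonzero π s ∑≢0 with ℕ-sum.sum-nonzero (λ i → if π i then free (s i) else 0) ∑≢0
... | i , term≢0 with π i in πi | s i in si
...   | true  | nothing = i , πi , si
...   | true  | just _  = contradiction refl term≢0
...   | false | _       = contradiction refl term≢0

odd⇒≢0 : ∀ {m} → parity m ≡ 1ℙ → m ≢ 0
odd⇒≢0 {zero}  ()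
odd⇒≢0 {suc m} _ ()

T-is-nothing : ∀ {A : Set} {m : Maybe A} → T (is-nothing m) → m ≡ nothing
T-is-nothing {m = nothing} _ = refl

∈-unlabeled⁺ : ∀ {n} (s : Labelling n) {w} → s w ≡ nothing → w ∈ unlabeled s
∈-unlabeled⁺ s {w} sw =
  ∈-filter⁺ (λ v → T? (is-nothing (s v))) (∈-allFin w) (subst (T ∘ is-nothing) (sym sw) tt)

∈-unlabeled⁻ : ∀ {n} (s : Labelling n) {w} → w ∈ unlabeled s → s w ≡ nothing
∈-unlabeled⁻ {n} s w∈ =
  T-is-nothing (proj₂ (∈-filter⁻ (λ v → T? (is-nothing (s v))) {xs = allFin n} w∈))

xor-spin : ∀ a b → (if a xor b then 1ℤ else -1ℤ) ≡ cross (spin a) (spin b)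
xor-spin false false = refl
xor-spin false true  = refl
xor-spin true  false = refl
xor-spin true  true  = refl

pos-cong : ∀ {ρ ρ′ σ σ′ X X′ Y Y′} → ρ ≡ ρ′ → σ ≡ σ′ → X ≡ X′ → Y ≡ Y′ →
           pos ρ σ X Y ≡ pos ρ′ σ′ X′ Y′
pos-cong refl refl refl refl = refl

module Bipartite (p q : ℕ) where
  n : ℕ
  n = p ℕ.+ q

  inQ : Fin n → Bool
  inQ i = not (side p i)

  side-< : ∀ {i j : Fin n} → side p i ≡ true → side p j ≡ false → toℕ i ℕ.< toℕ j
  side-< {i} {j} i∈P j∉P =
    ℕₚ.<-≤-trans (ℕₚ.<ᵇ⇒< (toℕ i) p (subst T (sym i∈P) tt)) (ℕₚ.≮⇒≥ (λ j<p → subst T j∉P (ℕₚ.<⇒<ᵇ j<p)))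

  spinP₀ spinQ₀ : Labelling n → ℤ
  spinP₀ = ℤ-sum.partSum (side p) (spin ∘ lab0)
  spinQ₀ = ℤ-sum.partSum inQ (spin ∘ lab0)

  edgeVal-K : ∀ (s : Labelling n) i j →
              (if toℕ i <ᵇ toℕ j then edgeVal (K p q) s (i , j) else 0ℤ)
              ≡ cross (if side p i then spin (lab0 (s i)) else 0ℤ) (if inQ j then spin (lab0 (s j)) else 0ℤ)
  edgeVal-K s i j with side p i in i∈P | side p j in j∈P | toℕ i <ᵇ toℕ j in i<j
  ... | true  | true  | c     = trans (if-eta c) (cong -_ (sym (ℤₚ.*-zeroʳ (spin (lab0 (s i))))))
  ... | false | false | c     = if-eta c
  ... | true  | false | true  = xor-spin (lab0 (s i)) (lab0 (s j))
  ... | true  | false | false = ⊥-elim (subst T i<j (ℕₚ.<⇒<ᵇ (side-< i∈P j∈P)))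
  ... | false | true  | true  =
    ⊥-elim (ℕₚ.<-asym (side-< j∈P i∈P) (ℕₚ.<ᵇ⇒< (toℕ i) (toℕ j) (subst T (sym i<j) tt)))
  ... | false | true  | false = refl

  discrepancy-K : ∀ (s : Labelling n) → discrepancy (K p q) s ≡ cross (spinP₀ s) (spinQ₀ s)
  discrepancy-K s = begin
    discrepancy (K p q) s
      ≡⟨ ListSum.sumList-pairs ℤₚ.+-0-monoid (edgeVal (K p q) s) ⟩
    ∑[ i < n ] ∑[ j < n ] (if toℕ i <ᵇ toℕ j then edgeVal (K p q) s (i , j) else 0ℤ)
      ≡⟨ sum-cong-≋ (λ i → sum-cong-≋ (edgeVal-K s i)) ⟩
    ∑[ i < n ] ∑[ j < n ] cross (X i) (Y j)
      ≡⟨ ∑-cross X Y ⟩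
    cross (spinP₀ s) (spinQ₀ s)
      ∎
    where
    open ≡-Reasoning
    open ℤ-sum using (sum-syntax; sum-cong-≋; ∑-cross)
    X Y : Fin n → ℤ
    X i = if side p i then spin (lab0 (s i)) else 0ℤ
    Y j = if inQ j then spin (lab0 (s j)) else 0ℤ

  position : Labelling n → Position
  position s = pos (parity (freeIn (side p) s)) (parity (freeIn inQ s)) (spinIn (side p) s) (spinIn inQ s)

  position-assign : ∀ pl (s : Labelling n) {w} → s w ≡ nothing →
                    position (assign s w (label pl)) ≡ move pl (side p w) (position s)
  position-assign pl s {w} sw with side p w in w∈P
  ... | true  = pos-cong (parity-freeIn-assign (side p) s w∈P sw)
                         (cong parity (ℕ-sum.partSum-assign-out inQ free s (cong not w∈P)))
                         (spinIn-assign (side p) s w∈P sw)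
                         (ℤ-sum.partSum-assign-out inQ labelSpin s (cong not w∈P))
  ... | false = pos-cong (cong parity (ℕ-sum.partSum-assign-out (side p) free s w∈P))
                         (parity-freeIn-assign inQ s (cong not w∈P) sw)
                         (ℤ-sum.partSum-assign-out (side p) labelSpin s w∈P)
                         (spinIn-assign inQ s (cong not w∈P) sw)

  position-complete : ∀ (s : Labelling n) → (∀ i → free (s i) ≡ 0) →
                      position s ≡ pos 0ℙ 0ℙ (spinP₀ s) (spinQ₀ s)
  position-complete s labelled =
    pos-cong (cong parity (ℕ-sum.partSum-ε (side p) free s labelled))
             (cong parity (ℕ-sum.partSum-ε inQ free s labelled))
             (ℤ-sum.partSum-cong (side p) labelSpin (spin ∘ lab0) s (labelSpin-complete ∘ labelled))
             (ℤ-sum.partSum-cong inQ labelSpin (spin ∘ lab0) s (labelSpin-complete ∘ labelled))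

  empty : Labelling n
  empty _ = nothing

  position-empty : position empty ≡ pos (parity p) (parity q) 0ℤ 0ℤ
  position-empty =
    pos-cong (cong parity (ℕ-sum.count-< n p (ℕₚ.m≤m+n p q)))
             (cong parity (trans (ℕ-sum.count-≥ n p) (ℕₚ.m+n∸m≡n p q)))
             (ℤ-sum.partSum-ε (side p) labelSpin empty (λ _ → refl))
             (ℤ-sum.partSum-ε inQ labelSpin empty (λ _ → refl))

  value-K : ∀ k pl (s : Labelling n) → freeCount s ≡ k → value (K p q) k pl s ≡ endgame pl (position s)
  value-K zero pl s none = begin
    discrepancy (K p q) s                         ≡⟨ discrepancy-K s ⟩
    endgame pl (pos 0ℙ 0ℙ (spinP₀ s) (spinQ₀ s))  ≡⟨ cong (endgame pl) (position-complete s labelled) ⟨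
    endgame pl (position s)                       ∎
    where
    open ≡-Reasoning
    labelled : ∀ i → free (s i) ≡ 0
    labelled = ℕ-sum.sum-≡0 (λ i → free (s i)) none
  value-K (suc k) pl s count with unlabeled s in unl≡
  ... | [] with freeIn-nonzero (λ _ → true) s (λ none → ℕₚ.1+n≢0 (trans (sym count) none))
  ...   | w , _ , sw with subst (w ∈_) unl≡ (∈-unlabeled⁺ s sw)
  ...     | ()
  value-K (suc k) pl s count | v ∷ vs =
    optimum-moves pl (position s) (side p) _ v vs after availableP availableQ
    where
    unlabelled : ∀ {w} → w ∈ v ∷ vs → s w ≡ nothing
    unlabelled w∈ = ∈-unlabeled⁻ s (subst (_ ∈_) (sym unl≡) w∈)
    after : ∀ {w} → w ∈ v ∷ vs → value (K p q) k (other pl) (assign s w (label pl))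
                                 ≡ endgame (other pl) (move pl (side p w) (position s))
    after {w} w∈ = trans (value-K k (other pl) _ count′) (cong (endgame (other pl)) (position-assign pl s (unlabelled w∈)))
      where
      count′ : freeCount (assign s w (label pl)) ≡ k
      count′ = ℕₚ.suc-injective (trans (freeIn-assign _ s refl (unlabelled w∈)) count)
    available : ∀ π → parity (freeIn π s) ≡ 1ℙ → ∃[ w ] w ∈ v ∷ vs × π w ≡ true
    available π odd with freeIn-nonzero π s (odd⇒≢0 odd)
    ... | w , πw , sw = w , subst (w ∈_) unl≡ (∈-unlabeled⁺ s sw) , πw
    availableP : parity (freeIn (side p) s) ≡ 1ℙ → ∃[ w ] w ∈ v ∷ vs × side p w ≡ true
    availableP = available (side p)
    availableQ : parity (freeIn inQ s) ≡ 1ℙ → ∃[ w ] w ∈ v ∷ vs × side p w ≡ false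
    availableQ odd with available inQ odd
    ... | w , w∈ , w∈Q = w , w∈ , not-injective w∈Q

  value-K-empty : ∀ pl → value (K p q) n pl empty ≡ + ((p ℕ.* q) ℕ.% 2)
  value-K-empty pl = begin
    value (K p q) n pl empty                       ≡⟨ value-K n pl empty (ℕ-sum.sum-ones n) ⟩
    endgame pl (position empty)                    ≡⟨ cong (endgame pl) position-empty ⟩
    endgame pl (pos (parity p) (parity q) 0ℤ 0ℤ)   ≡⟨ endgame-origin pl (parity p) (parity q) ⟩
    + bit (parity p ℙ.* parity q)                  ≡⟨ cong (+_ ∘ bit) (*-homo-* p q) ⟨
    + bit (parity (p ℕ.* q))                       ≡⟨ cong +_ (bit-parity (p ℕ.* q)) ⟩
    + ((p ℕ.* q) ℕ.% 2)                            ∎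
    where open ≡-Reasoning

proposition3p4 : (p q : ℕ) → 1 ℕ.≤ p → 1 ℕ.≤ q →
    ((p ℕ.* q) ℕ.% 2 ≡ 0 → bgA (K p q) ≡ + 0 × bgI (K p q) ≡ + 0) ×
    ((p ℕ.* q) ℕ.% 2 ≡ 1 → bgA (K p q) ≡ + 1 × bgI (K p q) ≡ + 1)
proposition3p4 p q _ _ = both , both
  where
  open Bipartite p q
  both : ∀ {r} → (p ℕ.* q) ℕ.% 2 ≡ r → bgA (K p q) ≡ + r × bgI (K p q) ≡ + r
  both pq%2 = trans (value-K-empty Adm) (cong +_ pq%2) , trans (value-K-empty Imp) (cong +_ pq%2)
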